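{- The TRS $\mathcal{R}_1$ is polynomially terminating over $\mathbb{N}$.
   Context: Signature: constant $\mathsf{0}$, unary $\mathsf{s},\mathsf{f},\mathsf{g}$, binary $\mathsf{h}$; $\mathsf{s}^n(x)$ denotes $n$-fold application of $\mathsf{s}$. $\mathcal{R}_1$ consists of the rules: $\mathsf{s}(\mathsf{0})\to\mathsf{f}(\mathsf{0})$; $\mathsf{s}^2(\mathsf{0})\to\mathsf{f}(\mathsf{s}(\mathsf{0}))$; $\mathsf{s}^7(\mathsf{0})\to\mathsf{f}(\mathsf{s}^2(\mathsf{0}))$; $\mathsf{f}(\mathsf{s}(\mathsf{0}))\to\mathsf{0}$; $\mathsf{f}(\mathsf{s}^2(\mathsf{0}))\to\mathsf{s}^5(\mathsf{0})$; $\mathsf{f}(\mathsf{s}^2(x))\to\mathsf{h}(\mathsf{f}(x),\mathsf{g}(\mathsf{h}(x,x)))$; $\mathsf{f}(\mathsf{g}(x))\to\mathsf{g}(\mathsf{g}(\mathsf{f}(x)))$; $\mathsf{g}(\mathsf{s}(x))\to\mathsf{s}(\mathsf{s}(\mathsf{g}(x)))$; $\mathsf{g}(x)\to\mathsf{h}(x,x)$; $\mathsf{s}(x)\to\mathsf{h}(\mathsf{0},x)$; $\mathsf{s}(x)\to\mathsf{h}(x,\mathsf{0})$; $\mathsf{h}(\mathsf{f}(x),\mathsf{g}(x))\to\mathsf{f}(\mathsf{s}(x))$. A polynomial interpretation over $\mathbb{N}$ assigns to each $n$-ary symbol $f$ a polynomial $f_\mathbb{N}\in\mathbb{Z}[x_1,\dots,x_n]$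 with $f_\mathbb{N}(\mathbb{N}^n)\subseteq\mathbb{N}$, strictly monotone in every argument w.r.t. the standard $>$ on $\mathbb{N}$; a TRS is polynomially terminating over $\mathbb{N}$ if some such interpretation satisfies $[\alpha](\ell)>[\alpha](r)$ for all rules $\ell\to r$ and all assignments $\alpha$ of variables into $\mathbb{N}$. -}

module Defs where

open import Data.Nat as ℕ using (ℕ)
open import Data.Integer as ℤ using (ℤ; +_)
open import Data.Fin using (Fin; zero; suc)
open import Data.List using (List; []; _∷_)
open import Data.List.Membership.Propositional using (_∈_)
open import Data.Product using (_×_; _,_; Σ)
open import Relation.Binary.PropositionalEquality using (_≡_; _≢_)

-- Multivariate integer polynomials ℤ[x₁,…,xₙ], given syntactically.
-- Every element of ℤ[x₁,…,xₙ] is denoted by some such expression, and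
-- only the denoted polynomial function matters below.

data Poly (n : ℕ) : Set where
  con  : ℤ → Poly n
  var  : Fin n → Poly n
  _⊕_  : Poly n → Poly n → Poly n
  _⊗_  : Poly n → Poly n → Poly n

evalPoly : ∀ {n} → Poly n → (Fin n → ℤ) → ℤ
evalPoly (con c) ρ = c
evalPoly (var i) ρ = ρ i
evalPoly (p ⊕ q) ρ = evalPoly p ρ ℤ.+ evalPoly q ρ
evalPoly (p ⊗ q) ρ = evalPoly p ρ ℤ.* evalPoly q ρ

evalℕ : ∀ {n} → Poly n → (Fin n → ℕ) → ℤ
evalℕ p a = evalPoly p (λ i → + (a i))

MapsℕToℕ : ∀ {n} → Poly n → Set
MapsℕToℕ p = ∀ a → + 0 ℤ.≤ evalℕ p a

StrictlyMonotone : ∀ {n} → Poly n → Set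
StrictlyMonotone {n} p =
  ∀ (a b : Fin n → ℕ) (i : Fin n) →
  (∀ j → j ≢ i → a j ≡ b j) → a i ℕ.< b i → evalℕ p a ℤ.< evalℕ p b

Admissible : ∀ {n} → Poly n → Set
Admissible p = MapsℕToℕ p × StrictlyMonotone p

data Term : Set where
  v  : ℕ → Term
  𝟘  : Term
  s  : Term → Term
  f  : Term → Term
  g  : Term → Term
  h  : Term → Term → Term

s^ : ℕ → Term → Term
s^ ℕ.zero t = t
s^ (ℕ.suc k) t = s (s^ k t)

R₁ : List (Term × Term)
R₁ =
    (s 𝟘 , f 𝟘)
  ∷ (s^ 2 𝟘 , f (s 𝟘))
  ∷ (s^ 7 𝟘 , f (s^ 2 𝟘))
  ∷ (f (s 𝟘) , 𝟘)
  ∷ (f (s^ 2 𝟘) , s^ 5 𝟘)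
  ∷ (f (s^ 2 x) , h (f x) (g (h x x)))
  ∷ (f (g x) , g (g (f x)))
  ∷ (g (s x) , s (s (g x)))
  ∷ (g x , h x x)
  ∷ (s x , h 𝟘 x)
  ∷ (s x , h x 𝟘)
  ∷ (h (f x) (g x) , f (s x))
  ∷ []
  where x = v 0

record PolyInterp : Set where
  field
    I𝟘 : Poly 0
    Is : Poly 1
    If : Poly 1
    Ig : Poly 1
    Ih : Poly 2
    adm𝟘 : Admissible I𝟘
    adms : Admissible Is
    admf : Admissible If
    admg : Admissible Ig
    admh : Admissible Ih

fin2 : ℤ → ℤ → Fin 2 → ℤ
fin2 x y zero = x
fin2 x y (suc _) = y

⟦_⟧ : Term → PolyInterp → (ℕ → ℕ) → ℤ
⟦ v k ⟧ I α = + (α k)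
⟦ 𝟘 ⟧ I α = evalPoly (PolyInterp.I𝟘 I) (λ ())
⟦ s t ⟧ I α = evalPoly (PolyInterp.Is I) (λ _ → ⟦ t ⟧ I α)
⟦ f t ⟧ I α = evalPoly (PolyInterp.If I) (λ _ → ⟦ t ⟧ I α)
⟦ g t ⟧ I α = evalPoly (PolyInterp.Ig I) (λ _ → ⟦ t ⟧ I α)
⟦ h t u ⟧ I α = evalPoly (PolyInterp.Ih I) (fin2 (⟦ t ⟧ I α) (⟦ u ⟧ I α))

Compatible : PolyInterp → List (Term × Term) → Set
Compatible I R = ∀ {l r} → (l , r) ∈ R → ∀ (α : ℕ → ℕ) → ⟦ r ⟧ I α ℤ.< ⟦ l ⟧ I α

PolynomiallyTerminating : List (Term × Term) → Set
PolynomiallyTerminating R = Σ PolyInterp λ I → Compatible I R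

module Submission where

-- The TRS R₁ is shown polynomially terminating by the interpretation
--
--   [0] = 0,  [s](x) = x + 1,  [f](x) = 2x² − x,  [g](x) = 4x + 4,  [h](x,y) = x + y.
--
-- The unary polynomials are
-- handled by one criterion: a unary polynomial that is nonnegative at 0 and
-- grows by a positive amount c·n + d + 1 from n to n + 1 maps ℕ to ℕ and is
-- strictly monotone.  This is what makes the non-monotone-looking [f] admissible:
-- [f](n + 1) = [f](n) + 4n + 1.
--
-- Compatibility: for every rule l → r, [l] − [r] is, as a polynomial in the
-- value n of the variable, of the form c·n + d + 1 with c, d ∈ ℕ (for the ground
-- rules it is the constant 1).

open import Defs
open import Data.Nat as ℕ using (ℕ; zero; suc)
import Data.Nat.Properties as ℕP
open import Data.Integer as ℤ using (ℤ; +_; -[1+_]; _+_; _*_; _<_; _≤_; +≤+; +<+)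
import Data.Integer.Properties as ℤP
open import Data.Integer.Tactic.RingSolver using (solve-∀)
open import Data.Fin using (Fin; zero; suc)
open import Data.List.Relation.Unary.All using (All; []; _∷_; lookup)
open import Data.Product using (_×_; _,_)
open import Data.Sum using (inj₁; inj₂)
open import Relation.Binary.PropositionalEquality

linear-gap-positive : ∀ c d n → + 0 < + c * + n + + suc d
linear-gap-positive c d n = begin-strict
  + 0                      <⟨ +<+ ℕP.0<1+n ⟩
  + suc (c ℕ.* n ℕ.+ d)    ≡⟨ cong +_ (sym (ℕP.+-suc (c ℕ.* n) d)) ⟩
  + (c ℕ.* n ℕ.+ suc d)    ≡⟨ ℤP.pos-+ (c ℕ.* n) (suc d) ⟩
  + (c ℕ.* n) + + suc d    ≡⟨ cong (_+ + suc d) (ℤP.pos-* c n) ⟩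
  + c * + n + + suc d      ∎
  where open ℤP.≤-Reasoning

gap⇒< : ∀ {l r} c d n → l ≡ r + (+ c * + n + + suc d) → r < l
gap⇒< {l} {r} c d n l≡r+gap = begin-strict
  r                            ≡⟨ sym (ℤP.+-identityʳ r) ⟩
  r + + 0                      <⟨ ℤP.+-monoʳ-< r (linear-gap-positive c d n) ⟩
  r + (+ c * + n + + suc d)    ≡⟨ sym l≡r+gap ⟩
  l                            ∎
  where open ℤP.≤-Reasoning

evalPoly-cong : ∀ {n} (p : Poly n) {ρ σ : Fin n → ℤ} →
                (∀ i → ρ i ≡ σ i) → evalPoly p ρ ≡ evalPoly p σ
evalPoly-cong (con c) ρ≗σ = refl
evalPoly-cong (var i) ρ≗σ = ρ≗σ i
evalPoly-cong (p ⊕ q) ρ≗σ = cong₂ _+_ (evalPoly-cong p ρ≗σ) (evalPoly-cong q ρ≗σ)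
evalPoly-cong (p ⊗ q) ρ≗σ = cong₂ _*_ (evalPoly-cong p ρ≗σ) (evalPoly-cong q ρ≗σ)

stepwise-increasing : (F : ℕ → ℤ) → (∀ n → F n < F (suc n)) →
                      ∀ {m n} → m ℕ.< n → F m < F n
stepwise-increasing F step {m} {suc n} (ℕ.s≤s m≤n) with ℕP.m≤n⇒m<n∨m≡n m≤n
... | inj₁ m<n   = ℤP.<-trans (stepwise-increasing F step m<n) (step n)
... | inj₂ refl  = step n

apply : Poly 1 → ℤ → ℤ
apply p x = evalPoly p (λ _ → x)

evalℕ-unary : (p : Poly 1) (a : Fin 1 → ℕ) → evalℕ p a ≡ apply p (+ a zero)
evalℕ-unary p a = evalPoly-cong p λ { zero → refl }

unary-admissible : (p : Poly 1) (c d : ℕ) → + 0 ≤ apply p (+ 0) →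
                   (∀ x → apply p (+ 1 + x) ≡ apply p x + (+ c * x + + suc d)) →
                   Admissible p
unary-admissible p c d nonneg-at-0 step = maps-ℕ-to-ℕ , strictly-monotone
  where
  P : ℕ → ℤ
  P n = apply p (+ n)

  increasing : ∀ {m n} → m ℕ.< n → P m < P n
  increasing = stepwise-increasing P (λ n → gap⇒< c d n (step (+ n)))

  maps-ℕ-to-ℕ : MapsℕToℕ p
  maps-ℕ-to-ℕ a with a zero | evalℕ-unary p a
  ... | zero  | eq = subst (+ 0 ≤_) (sym eq) nonneg-at-0
  ... | suc n | eq = subst (+ 0 ≤_) (sym eq)
                       (ℤP.≤-trans nonneg-at-0 (ℤP.<⇒≤ (increasing (ℕ.s≤s ℕ.z≤n))))

  strictly-monotone : StrictlyMonotone p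
  strictly-monotone a b zero _ a<b
    rewrite evalℕ-unary p a | evalℕ-unary p b = increasing a<b

-- The interpretation.  The integer functions are inlined so that the ring
-- solver sees the polynomials they stand for.

sℤ : ℤ → ℤ
sℤ x = x + + 1
{-# INLINE sℤ #-}

fℤ : ℤ → ℤ
fℤ x = + 2 * (x * x) + -[1+ 0 ] * x
{-# INLINE fℤ #-}

gℤ : ℤ → ℤ
gℤ x = + 4 * x + + 4
{-# INLINE gℤ #-}

hℤ : ℤ → ℤ → ℤ
hℤ x y = x + y
{-# INLINE hℤ #-}

x₀ : Poly 1
x₀ = var zero

-- The polynomials evaluate definitionally to the functions above.
[0] : Poly 0
[0] = con (+ 0)

[s] [f] [g] : Poly 1
[s] = x₀ ⊕ con (+ 1)
[f] = (con (+ 2) ⊗ (x₀ ⊗ x₀)) ⊕ (con -[1+ 0 ] ⊗ x₀)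
[g] = (con (+ 4) ⊗ x₀) ⊕ con (+ 4)

[h] : Poly 2
[h] = var zero ⊕ var (suc zero)

sℤ-step : ∀ x → sℤ (+ 1 + x) ≡ sℤ x + (+ 0 * x + + 1)
sℤ-step = solve-∀

fℤ-step : ∀ x → fℤ (+ 1 + x) ≡ fℤ x + (+ 4 * x + + 1)
fℤ-step = solve-∀

gℤ-step : ∀ x → gℤ (+ 1 + x) ≡ gℤ x + (+ 0 * x + + 4)
gℤ-step = solve-∀

[0]-admissible : Admissible [0]
[0]-admissible = (λ _ → +≤+ ℕ.z≤n) , λ _ _ ()

[h]-admissible : Admissible [h]
[h]-admissible = (λ _ → +≤+ ℕ.z≤n) , strictly-monotone
  where
  strictly-monotone : StrictlyMonotone [h]
  strictly-monotone a b zero others-equal a<b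
    rewrite others-equal (suc zero) (λ ()) = ℤP.+-monoˡ-< (+ b (suc zero)) (+<+ a<b)
  strictly-monotone a b (suc zero) others-equal a<b
    rewrite others-equal zero (λ ()) = ℤP.+-monoʳ-< (+ b zero) (+<+ a<b)

interpretation : PolyInterp
interpretation = record
  { I𝟘 = [0] ; Is = [s] ; If = [f] ; Ig = [g] ; Ih = [h]
  ; adm𝟘 = [0]-admissible
  ; adms = unary-admissible [s] 0 0 (+≤+ ℕ.z≤n) sℤ-step
  ; admf = unary-admissible [f] 4 0 (+≤+ ℕ.z≤n) fℤ-step
  ; admg = unary-admissible [g] 0 3 (+≤+ ℕ.z≤n) gℤ-step
  ; admh = [h]-admissible
  }

f∘s²-gap : ∀ x → fℤ (sℤ (sℤ x)) ≡ hℤ (fℤ x) (gℤ (hℤ x x)) + (+ 0 * x + + 2)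
f∘s²-gap = solve-∀

f∘g-gap : ∀ x → fℤ (gℤ x) ≡ gℤ (gℤ (fℤ x)) + (+ 76 * x + + 8)
f∘g-gap = solve-∀

g∘s-gap : ∀ x → gℤ (sℤ x) ≡ sℤ (sℤ (gℤ x)) + (+ 0 * x + + 2)
g∘s-gap = solve-∀

g-gap : ∀ x → gℤ x ≡ hℤ x x + (+ 2 * x + + 4)
g-gap = solve-∀

s-gapˡ : ∀ x → sℤ x ≡ hℤ (+ 0) x + (+ 0 * x + + 1)
s-gapˡ = solve-∀

s-gapʳ : ∀ x → sℤ x ≡ hℤ x (+ 0) + (+ 0 * x + + 1)
s-gapʳ = solve-∀

h∘fg-gap : ∀ x → hℤ (fℤ x) (gℤ x) ≡ fℤ (sℤ x) + (+ 0 * x + + 3)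
h∘fg-gap = solve-∀

Oriented : Term × Term → Set
Oriented (l , r) = ∀ (α : ℕ → ℕ) → ⟦ r ⟧ interpretation α < ⟦ l ⟧ interpretation α

-- The ground rules have gap exactly 1, by computation; the others use the
-- identities above at x = α(0).
rules-oriented : All Oriented R₁
rules-oriented =
    (λ α → gap⇒< 0 0 0 refl)
  ∷ (λ α → gap⇒< 0 0 0 refl)
  ∷ (λ α → gap⇒< 0 0 0 refl)
  ∷ (λ α → gap⇒< 0 0 0 refl)
  ∷ (λ α → gap⇒< 0 0 0 refl)
  ∷ (λ α → gap⇒< 0 1 (α 0) (f∘s²-gap (+ α 0)))
  ∷ (λ α → gap⇒< 76 7 (α 0) (f∘g-gap (+ α 0)))
  ∷ (λ α → gap⇒< 0 1 (α 0) (g∘s-gap (+ α 0)))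
  ∷ (λ α → gap⇒< 2 3 (α 0) (g-gap (+ α 0)))
  ∷ (λ α → gap⇒< 0 0 (α 0) (s-gapˡ (+ α 0)))
  ∷ (λ α → gap⇒< 0 0 (α 0) (s-gapʳ (+ α 0)))
  ∷ (λ α → gap⇒< 0 2 (α 0) (h∘fg-gap (+ α 0)))
  ∷ []

lemma4p3 : PolynomiallyTerminating R₁
lemma4p3 = interpretation , lookup rules-oriented
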